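{- For every nonnegative integer $n$, every set $A$ of nimbers and special moons with $*n\in A$, and every $X\in\langle\widetilde{\mathrm{Ims}}^\infty\cup\widetilde{\mathrm{LIm}}\rangle$, we have $o(\mathrm{SMoon}(n)_A+X)\in\{\mathcal N,\mathcal D\}$.
   Context: Games. Two players, Left and Right, alternate; a position $G$ is determined by its set $G^{\mathcal L}$ of Left options and $G^{\mathcal R}$ of Right options, written $G\cong\{G^{\mathcal L}\mid G^{\mathcal R}\}$. The disjunctive sum is $G+H\cong\{G^{\mathcal L}+H,\,G+H^{\mathcal L}\mid G^{\mathcal R}+H,\,G+H^{\mathcal R}\}$. Normal play: a player with no move loses. The outcome $o(G)$ is $\mathcal N$ if the player to move can force a win, $\mathcal P$ if the other player can, $\mathcal L$ (resp. $\mathcal R$) if Left (resp. Right) can force a win whoever starts, and $\mathcal D$ (draw) if under optimal play neither player can force a win. Nimbers: $*0=0\cong\{\,\mid\,\}$, $*n\cong\{*0,\dots,*(n-1)\mid *0,\dots,*(n-1)\}$. Impartial loopy games: $\widetilde{\mathrm{LIm}}$ is the set of positions of impartial rulesets (Left and Right options coincide) in which play need not terminate. Impartial entailing games: positions (short) built recursively from $\infty$ and $\overline\infty$, immediate wins for Left and Right respectively ($o(\infty)=\mathcal L$, $o(\overline\infty)=\mathcal R$, $\infty+X=\infty$ for $X\neq\overline\infty$, $\overline\infty+X=\overline\infty$ for $X\neq\infty$). Conjugate: $\infty,\overline\infty$ conjugate to each other, otherwise $\overline G=\{\overline{G^{\mathcal R}}\mid\overline{G^{\mathcal L}}\}$.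 $G$ is symmetric if $G\notin\{\infty,\overline\infty\}$ and $G^{\mathcal R}=\overline{G^{\mathcal L}}$; quiet if $G\notin\{\infty,\overline\infty\}$, $\infty\notin G^{\mathcal L}$, $\overline\infty\notin G^{\mathcal R}$. $\widetilde{\mathrm{Im}}^\infty$ = symmetric positions all of whose quiet followers are symmetric; $G=_{\widetilde{\mathrm{Im}}^\infty}H$ iff $o(G+X)=o(H+X)$ for all $X\in\widetilde{\mathrm{Im}}^\infty$. $\mathrm{Moon}\cong\{\infty\mid\overline\infty\}$. Special moon: $\mathrm{SMoon}(n)_A\cong\{\{\infty\mid *n\},A\mid A,\{*n\mid\overline\infty\}\}$, $A$ a set of nimbers and previously constructed special moons with $*n\in A$. $\widetilde{\mathrm{Ims}}^\infty$ is the set of $G\in\widetilde{\mathrm{Im}}^\infty$ with $G=_{\widetilde{\mathrm{Im}}^\infty}*k$ for some $k$, or $G\cong\mathrm{Moon}$, or $G\cong\mathrm{SMoon}(n)_A$ for some $n,A$. $\langle\widetilde{\mathrm{Ims}}^\infty\cup\widetilde{\mathrm{LIm}}\rangle$ is the set of finite sums $G_1+\dots+G_r+H_1+\dots+H_s$ with $G_i\in\widetilde{\mathrm{Ims}}^\infty$, $H_j\in\widetilde{\mathrm{LIm}}$. By convention, $o(\infty+X)=\mathcal L$ and $o(\overline\infty+X)=\mathcal R$ for every $X$ in this set. -}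

module Defs where

open import Level using (Level)
open import Data.Nat using (ℕ; zero; suc)
open import Data.List using (List; []; _∷_; _++_; [_])
open import Data.List.Membership.Propositional using (_∈_)
open import Data.List.Relation.Unary.All using (All)
open import Data.List.Relation.Unary.Any using (Any)
open import Data.Product using (Σ; _×_; _,_; proj₁)
open import Data.Sum using (_⊎_)
open import Data.Empty using (⊥)
open import Relation.Nullary using (¬_)
open import Relation.Binary.PropositionalEquality using (_≡_)

-- Short entailing game forms.  Option *sets* are represented by lists;
-- identity of games (≅) is set-equality of options, recursively.

data EGame : Set where
  ∞  : EGame                         -- immediate win for Left
  ∞̄  : EGame                         -- immediate win for Right
  ⟨_∣_⟩ : List EGame → List EGame → EGame

leftOpts rightOpts : EGame → List EGame
leftOpts ⟨ L ∣ R ⟩ = L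
leftOpts _ = []
rightOpts ⟨ L ∣ R ⟩ = R
rightOpts _ = []

SetEq : (EGame → EGame → Set) → List EGame → List EGame → Set
SetEq rel L L' = All (λ x → Any (λ y → rel x y) L') L × All (λ y → Any (λ x → rel x y) L) L'

data _≅_ : EGame → EGame → Set where
  ∞≅∞   : ∞ ≅ ∞
  ∞̄≅∞̄   : ∞̄ ≅ ∞̄
  node≅ : ∀ {L R L' R'} →
          All (λ x → Any (λ y → x ≅ y) L') L → All (λ y → Any (λ x → x ≅ y) L) L' →
          All (λ x → Any (λ y → x ≅ y) R') R → All (λ y → Any (λ x → x ≅ y) R) R' →
          ⟨ L ∣ R ⟩ ≅ ⟨ L' ∣ R' ⟩

mutual
  conj : EGame → EGame
  conj ∞ = ∞̄
  conj ∞̄ = ∞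
  conj ⟨ L ∣ R ⟩ = ⟨ conjList R ∣ conjList L ⟩

  conjList : List EGame → List EGame
  conjList [] = []
  conjList (x ∷ xs) = conj x ∷ conjList xs

Symmetric : EGame → Set
Symmetric ∞ = ⊥
Symmetric ∞̄ = ⊥
Symmetric ⟨ L ∣ R ⟩ = SetEq _≅_ R (conjList L)

Quiet : EGame → Set
Quiet ∞ = ⊥
Quiet ∞̄ = ⊥
Quiet ⟨ L ∣ R ⟩ = ¬ (∞ ∈ L) × ¬ (∞̄ ∈ R)

data Follower : EGame → EGame → Set where
  self   : ∀ {G} → Follower G G
  viaL   : ∀ {F H L R} → H ∈ L → Follower F H → Follower F ⟨ L ∣ R ⟩
  viaR   : ∀ {F H L R} → H ∈ R → Follower F H → Follower F ⟨ L ∣ R ⟩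

InIm : EGame → Set
InIm G = Symmetric G × (∀ F → Follower F G → Quiet F → Symmetric F)

nimList : ℕ → List EGame          -- list of *(n-1), …, *0
nimList zero = []
nimList (suc n) = ⟨ nimList n ∣ nimList n ⟩ ∷ nimList n

nim : ℕ → EGame
nim n = ⟨ nimList n ∣ nimList n ⟩

Moon : EGame
Moon = ⟨ [ ∞ ] ∣ [ ∞̄ ] ⟩

SMoon : ℕ → List EGame → EGame
SMoon n A = ⟨ ⟨ [ ∞ ] ∣ [ nim n ] ⟩ ∷ A ∣ A ++ [ ⟨ [ nim n ] ∣ [ ∞̄ ] ⟩ ] ⟩

mutual
  data NimOrSMoon : EGame → Set where
    isNim   : ∀ m → NimOrSMoon (nim m)
    isSMoon : ∀ m B → SMoonArg m B → NimOrSMoon (SMoon m B)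

  data SMoonArg (n : ℕ) (A : List EGame) : Set where
    mkArg : All NimOrSMoon A → nim n ∈ A → SMoonArg n A

-- Impartial loopy games: a ruleset (arbitrary position type, finitely
-- many options per position) together with a position.

record Ruleset : Set₁ where
  field
    Pos  : Set
    opts : Pos → List Pos
open Ruleset public

LPos : Set₁
LPos = Σ Ruleset Pos

-- Disjunctive sums G₁+…+Gᵣ+H₁+…+Hₛ as states of play

State : Set₁
State = List EGame × List LPos

data Player : Set where
  Lt Rt : Player

opp : Player → Player
opp Lt = Rt
opp Rt = Lt

optsOf : Player → EGame → List EGame
optsOf Lt = leftOpts
optsOf Rt = rightOpts

data Move (p : Player) : State → State → Set₁ where
  entMove  : ∀ pre post G G' Hs → G' ∈ optsOf p G →
             Move p (pre ++ G ∷ post , Hs) (pre ++ G' ∷ post , Hs)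
  loopMove : ∀ Gs pre post (Rs : Ruleset) (x y : Pos Rs) → y ∈ opts Rs x →
             Move p (Gs , pre ++ (Rs , x) ∷ post) (Gs , pre ++ (Rs , y) ∷ post)

Won : Player → State → Set
Won Lt s = Any (λ G → G ≡ ∞) (proj₁ s)
Won Rt s = Any (λ G → G ≡ ∞̄) (proj₁ s)

Terminal : State → Set
Terminal s = Won Lt s ⊎ Won Rt s

-- Wins w p s : player w can force a win (in finitely many moves)
-- from s when p is to move.  Normal play: a player with no move loses.
data Wins (w : Player) : Player → State → Set₁ where
  won   : ∀ {p s} → Won w s → Wins w p s
  moveW : ∀ {s} s' → ¬ Terminal s → Move w s s' → Wins w (opp w) s' → Wins w w s
  allW  : ∀ {s} → ¬ Terminal s → (∀ s' → Move (opp w) s s' → Wins w w s') → Wins w (opp w) s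

data Outcome : Set where
  𝓛 𝓡 𝓝 𝓟 𝓓 : Outcome

HasOutcome : State → Outcome → Set₁
HasOutcome s 𝓛 = Wins Lt Lt s × Wins Lt Rt s
HasOutcome s 𝓡 = Wins Rt Lt s × Wins Rt Rt s
HasOutcome s 𝓝 = Wins Lt Lt s × Wins Rt Rt s
HasOutcome s 𝓟 = Wins Rt Lt s × Wins Lt Rt s
HasOutcome s 𝓓 = ¬ Wins Lt Lt s × ¬ Wins Rt Lt s × ¬ Wins Lt Rt s × ¬ Wins Rt Rt s

SameOutcome : State → State → Set₁
SameOutcome s t = ∀ o → (HasOutcome s o → HasOutcome t o) × (HasOutcome t o → HasOutcome s o)

_=Im_ : EGame → EGame → Set₁
G =Im H = ∀ X → InIm X → SameOutcome (G ∷ X ∷ [] , []) (H ∷ X ∷ [] , [])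

InIms : EGame → Set₁
InIms G = InIm G ×
  ((Σ ℕ λ k → G =Im nim k) ⊎ (G ≅ Moon) ⊎
   (Σ ℕ λ n → Σ (List EGame) λ A → SMoonArg n A × G ≅ SMoon n A))

-- Conjugation fixes nimbers, special moons and symmetric positions up to identity, and the
-- loopy components are impartial, so the sum s = SMoon(n)_A + X is self-conjugate: a player
-- can force a win from s with p to move exactly when the opponent can with the opponent of p
-- to move.  Hence it suffices that Right cannot win s when Left starts.  If some component of
-- X has ∞ as a Left option, Left takes it.  Otherwise Left moves to {∞ | *n}; every Right
-- reply away from this component is answered by ∞ (by symmetry no component of X lets Right
-- reach ∞̄), and the reply *n leaves *n + X with Left to move, which by self-conjugacy Right
-- wins only if Left wins *n + X with Right to move; but Left could have moved to *n + X at
-- once, since *n ∈ A.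
module Submission where

open import Defs
open import Function using (_∘_)
open import Data.Nat using (ℕ; zero; suc)
open import Data.List using (List; []; _∷_; _++_; [_])
open import Data.List.Membership.Propositional using (_∈_; find)
open import Data.List.Relation.Unary.All as All using (All; []; _∷_)
open import Data.List.Relation.Unary.All.Properties as Allₚ using (All¬⇒¬Any; ¬Any⇒All¬)
open import Data.List.Relation.Unary.Any as Any using (Any; here; there)
import Data.List.Relation.Unary.Any.Properties as Anyₚ
open import Data.List.Relation.Binary.Pointwise as Pointwise using (Pointwise; []; _∷_)
open import Data.Product using (∃; ∃₂; _×_; _,_; proj₁; proj₂)
open import Data.Sum as Sum using (_⊎_; inj₁; inj₂)
open import Data.Empty using (⊥)
open import Relation.Nullary using (¬_)
open import Relation.Binary.PropositionalEquality
  using (_≡_; _≢_; refl; sym; cong; cong₂; subst; subst₂)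

mutual
  ≅-refl : ∀ G → G ≅ G
  ≅-refl ∞ = ∞≅∞
  ≅-refl ∞̄ = ∞̄≅∞̄
  ≅-refl ⟨ L ∣ R ⟩ = node≅ (≅-reflˡ L) (≅-reflʳ L) (≅-reflˡ R) (≅-reflʳ R)

  ≅-reflˡ : ∀ xs → All (λ x → Any (x ≅_) xs) xs
  ≅-reflˡ [] = []
  ≅-reflˡ (x ∷ xs) = here (≅-refl x) ∷ All.map there (≅-reflˡ xs)

  ≅-reflʳ : ∀ xs → All (λ y → Any (_≅ y) xs) xs
  ≅-reflʳ [] = []
  ≅-reflʳ (x ∷ xs) = here (≅-refl x) ∷ All.map there (≅-reflʳ xs)

mutual
  ≅-sym : ∀ {G H} → G ≅ H → H ≅ G
  ≅-sym ∞≅∞ = ∞≅∞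
  ≅-sym ∞̄≅∞̄ = ∞̄≅∞̄
  ≅-sym (node≅ a b c d) = node≅ (≅-symʳ b) (≅-symˡ a) (≅-symʳ d) (≅-symˡ c)

  ≅-symʳ : ∀ {L L'} → All (λ y → Any (_≅ y) L) L' → All (λ x → Any (x ≅_) L) L'
  ≅-symʳ [] = []
  ≅-symʳ (p ∷ ps) = Any-≅-symʳ p ∷ ≅-symʳ ps

  ≅-symˡ : ∀ {L L'} → All (λ x → Any (x ≅_) L') L → All (λ y → Any (_≅ y) L') L
  ≅-symˡ [] = []
  ≅-symˡ (p ∷ ps) = Any-≅-symˡ p ∷ ≅-symˡ ps

  Any-≅-symʳ : ∀ {L y} → Any (_≅ y) L → Any (y ≅_) L
  Any-≅-symʳ (here e) = here (≅-sym e)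
  Any-≅-symʳ (there p) = there (Any-≅-symʳ p)

  Any-≅-symˡ : ∀ {L x} → Any (x ≅_) L → Any (_≅ x) L
  Any-≅-symˡ (here e) = here (≅-sym e)
  Any-≅-symˡ (there p) = there (Any-≅-symˡ p)

mutual
  conj-involutive : ∀ G → conj (conj G) ≡ G
  conj-involutive ∞ = refl
  conj-involutive ∞̄ = refl
  conj-involutive ⟨ L ∣ R ⟩ = cong₂ ⟨_∣_⟩ (conjList-involutive L) (conjList-involutive R)

  conjList-involutive : ∀ xs → conjList (conjList xs) ≡ xs
  conjList-involutive [] = refl
  conjList-involutive (x ∷ xs) = cong₂ _∷_ (conj-involutive x) (conjList-involutive xs)

conj-swap : ∀ {x y} → conj x ≡ y → x ≡ conj y
conj-swap {x} refl = sym (conj-involutive x)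

conjList-++ : ∀ xs ys → conjList (xs ++ ys) ≡ conjList xs ++ conjList ys
conjList-++ [] ys = refl
conjList-++ (x ∷ xs) ys = cong (conj x ∷_) (conjList-++ xs ys)

conjList-Any⁺ : ∀ {P : EGame → Set} {xs} → Any (P ∘ conj) xs → Any P (conjList xs)
conjList-Any⁺ (here p) = here p
conjList-Any⁺ (there p) = there (conjList-Any⁺ p)

conjList-Any⁻ : ∀ {P : EGame → Set} {xs} → Any P (conjList xs) → Any (P ∘ conj) xs
conjList-Any⁻ {xs = x ∷ xs} (here p) = here p
conjList-Any⁻ {xs = x ∷ xs} (there p) = there (conjList-Any⁻ p)

conjList-∈⁺ : ∀ {x xs} → x ∈ xs → conj x ∈ conjList xs
conjList-∈⁺ = conjList-Any⁺ ∘ Any.map (cong conj)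

conjList-nimList : ∀ n → conjList (nimList n) ≡ nimList n
conjList-nimList zero = refl
conjList-nimList (suc n) =
  cong₂ _∷_ (cong₂ ⟨_∣_⟩ (conjList-nimList n) (conjList-nimList n)) (conjList-nimList n)

conj-nim : ∀ n → conj (nim n) ≡ nim n
conj-nim n = cong₂ ⟨_∣_⟩ (conjList-nimList n) (conjList-nimList n)

mutual
  conj-resp-≅ : ∀ {G H} → G ≅ H → conj G ≅ conj H
  conj-resp-≅ ∞≅∞ = ∞̄≅∞̄
  conj-resp-≅ ∞̄≅∞̄ = ∞≅∞
  conj-resp-≅ (node≅ a b c d) =
    node≅ (conjList-resp-≅ˡ c) (conjList-resp-≅ʳ d) (conjList-resp-≅ˡ a) (conjList-resp-≅ʳ b)

  conjList-resp-≅ˡ : ∀ {R R'} → All (λ x → Any (x ≅_) R') R →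
                     All (λ x → Any (x ≅_) (conjList R')) (conjList R)
  conjList-resp-≅ˡ [] = []
  conjList-resp-≅ˡ (p ∷ ps) = Any-conj-resp-≅ˡ p ∷ conjList-resp-≅ˡ ps

  conjList-resp-≅ʳ : ∀ {L L'} → All (λ y → Any (_≅ y) L) L' →
                     All (λ y → Any (_≅ y) (conjList L)) (conjList L')
  conjList-resp-≅ʳ [] = []
  conjList-resp-≅ʳ (p ∷ ps) = Any-conj-resp-≅ʳ p ∷ conjList-resp-≅ʳ ps

  Any-conj-resp-≅ˡ : ∀ {R' x} → Any (x ≅_) R' → Any (conj x ≅_) (conjList R')
  Any-conj-resp-≅ˡ (here e) = here (conj-resp-≅ e)
  Any-conj-resp-≅ˡ (there p) = there (Any-conj-resp-≅ˡ p)

  Any-conj-resp-≅ʳ : ∀ {L y} → Any (_≅ y) L → Any (_≅ conj y) (conjList L)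
  Any-conj-resp-≅ʳ (here e) = here (conj-resp-≅ e)
  Any-conj-resp-≅ʳ (there p) = there (Any-conj-resp-≅ʳ p)

Symmetric⇒conj≅ : ∀ G → Symmetric G → conj G ≅ G
Symmetric⇒conj≅ ⟨ L ∣ R ⟩ (R⊆L̄ , L̄⊆R) = node≅ R̄⊆L L⊆R̄ (≅-symʳ L̄⊆R) (≅-symˡ R⊆L̄)
  where
  R̄⊆L : All (λ x → Any (x ≅_) L) (conjList R)
  R̄⊆L = subst (λ Z → All (λ x → Any (x ≅_) Z) (conjList R)) (conjList-involutive L)
              (conjList-resp-≅ˡ R⊆L̄)
  L⊆R̄ : All (λ y → Any (_≅ y) (conjList R)) L
  L⊆R̄ = subst (All (λ y → Any (_≅ y) (conjList R))) (conjList-involutive L) (conjList-resp-≅ʳ L̄⊆R)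

conj-nim≅ : ∀ n → conj (nim n) ≅ nim n
conj-nim≅ n = subst (_≅ nim n) (sym (conj-nim n)) (≅-refl (nim n))

SMoon-symmetric : ∀ n A → All (λ a → conj a ≅ a) A → Symmetric (SMoon n A)
SMoon-symmetric n A Ā≅A =
  Allₚ.++⁺ (All.map there (⊆conj Ā≅A)) (here right∞̄≅ ∷ []) ,
  (Anyₚ.++⁺ʳ A (here right∞̄≅) ∷ All.map Anyₚ.++⁺ˡ (conj⊆ Ā≅A))
  where
  right∞̄≅ : ⟨ [ nim n ] ∣ [ ∞̄ ] ⟩ ≅ conj ⟨ [ ∞ ] ∣ [ nim n ] ⟩
  right∞̄≅ = node≅ (here (≅-sym (conj-nim≅ n)) ∷ []) (here (≅-sym (conj-nim≅ n)) ∷ [])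
                  (here ∞̄≅∞̄ ∷ []) (here ∞̄≅∞̄ ∷ [])
  ⊆conj : ∀ {B} → All (λ a → conj a ≅ a) B → All (λ x → Any (x ≅_) (conjList B)) B
  ⊆conj [] = []
  ⊆conj (e ∷ es) = here (≅-sym e) ∷ All.map there (⊆conj es)
  conj⊆ : ∀ {B} → All (λ a → conj a ≅ a) B → All (λ y → Any (_≅ y) B) (conjList B)
  conj⊆ [] = []
  conj⊆ (e ∷ es) = here (≅-sym e) ∷ All.map there (conj⊆ es)

mutual
  NimOrSMoon⇒conj≅ : ∀ {G} → NimOrSMoon G → conj G ≅ G
  NimOrSMoon⇒conj≅ (isNim m) = conj-nim≅ m
  NimOrSMoon⇒conj≅ (isSMoon m B (mkArg all _)) =
    Symmetric⇒conj≅ (SMoon m B) (SMoon-symmetric m B (NimOrSMoons⇒conj≅ all))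

  NimOrSMoons⇒conj≅ : ∀ {B} → All NimOrSMoon B → All (λ a → conj a ≅ a) B
  NimOrSMoons⇒conj≅ [] = []
  NimOrSMoons⇒conj≅ (p ∷ ps) = NimOrSMoon⇒conj≅ p ∷ NimOrSMoons⇒conj≅ ps

conjList-≅ : ∀ {Gs} → All Symmetric Gs → Pointwise _≅_ (conjList Gs) Gs
conjList-≅ [] = []
conjList-≅ (s ∷ ss) = Symmetric⇒conj≅ _ s ∷ conjList-≅ ss

infix 4 _≅ₛ_
_≅ₛ_ : State → State → Set₁
s ≅ₛ s' = Pointwise _≅_ (proj₁ s) (proj₁ s') × proj₂ s ≡ proj₂ s'

≅ₛ-sym : ∀ {s s'} → s ≅ₛ s' → s' ≅ₛ s
≅ₛ-sym (Gs≅ , Hs≡) = Pointwise.symmetric ≅-sym Gs≅ , sym Hs≡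

Any-resp-Pointwise-≅ : ∀ {P : EGame → Set} → (∀ {x y} → x ≅ y → P x → P y) →
                       ∀ {xs ys} → Pointwise _≅_ xs ys → Any P xs → Any P ys
Any-resp-Pointwise-≅ resp (e ∷ _) (here p) = here (resp e p)
Any-resp-Pointwise-≅ resp (_ ∷ es) (there p) = there (Any-resp-Pointwise-≅ resp es p)

Won-resp-≅ₛ : ∀ w {s s'} → s ≅ₛ s' → Won w s → Won w s'
Won-resp-≅ₛ Lt (Gs≅ , _) = Any-resp-Pointwise-≅ (λ { ∞≅∞ refl → refl }) Gs≅
Won-resp-≅ₛ Rt (Gs≅ , _) = Any-resp-Pointwise-≅ (λ { ∞̄≅∞̄ refl → refl }) Gs≅

Terminal-resp-≅ₛ : ∀ {s s'} → s ≅ₛ s' → Terminal s → Terminal s'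
Terminal-resp-≅ₛ r = Sum.map (Won-resp-≅ₛ Lt r) (Won-resp-≅ₛ Rt r)

Pointwise-≅-split : ∀ pre {G post ys} → Pointwise _≅_ (pre ++ G ∷ post) ys →
  ∃₂ λ pre' post' → ∃ λ G' →
  ys ≡ pre' ++ G' ∷ post' × Pointwise _≅_ pre pre' × G ≅ G' × Pointwise _≅_ post post'
Pointwise-≅-split [] (e ∷ es) = [] , _ , _ , refl , [] , e , es
Pointwise-≅-split (x ∷ pre) (e ∷ es) with Pointwise-≅-split pre es
... | pre' , post' , G' , refl , pre≅ , G≅ , post≅ =
  _ ∷ pre' , post' , G' , refl , e ∷ pre≅ , G≅ , post≅

optsOf-resp-≅ : ∀ p {G H G'} → G ≅ H → G' ∈ optsOf p G → ∃ λ H' → H' ∈ optsOf p H × G' ≅ H'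
optsOf-resp-≅ Lt (node≅ L⊆L' _ _ _) m = find (All.lookup L⊆L' m)
optsOf-resp-≅ Rt (node≅ _ _ R⊆R' _) m = find (All.lookup R⊆R' m)

Move-resp-≅ₛ : ∀ {p s s₁ s'} → Move p s s₁ → s ≅ₛ s' → ∃ λ s₁' → Move p s' s₁' × s₁ ≅ₛ s₁'
Move-resp-≅ₛ {p} (entMove pre post G G₁ Hs m) (Gs≅ , refl) with Pointwise-≅-split pre Gs≅
... | pre' , post' , G' , refl , pre≅ , G≅ , post≅ with optsOf-resp-≅ p G≅ m
... | G₁' , m' , G₁≅ =
  _ , entMove pre' post' G' G₁' Hs m' , Pointwise.++⁺ pre≅ (G₁≅ ∷ post≅) , refl
Move-resp-≅ₛ {s' = Gs' , _} (loopMove Gs pre post Rs x y m) (Gs≅ , refl) =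
  _ , loopMove Gs' pre post Rs x y m , Gs≅ , refl

Wins-resp-≅ₛ : ∀ {w p s s'} → s ≅ₛ s' → Wins w p s → Wins w p s'
Wins-resp-≅ₛ {w} r (won x) = won (Won-resp-≅ₛ w r x)
Wins-resp-≅ₛ r (moveW s₁ nt mv W) with Move-resp-≅ₛ mv r
... | s₁' , mv' , r₁ = moveW s₁' (nt ∘ Terminal-resp-≅ₛ (≅ₛ-sym r)) mv' (Wins-resp-≅ₛ r₁ W)
Wins-resp-≅ₛ r (allW nt f) = allW (nt ∘ Terminal-resp-≅ₛ (≅ₛ-sym r)) λ s₁' mv' →
  let s₁ , mv , r₁ = Move-resp-≅ₛ mv' (≅ₛ-sym r) in Wins-resp-≅ₛ (≅ₛ-sym r₁) (f s₁ mv)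

conjS : State → State
conjS (Gs , Hs) = conjList Gs , Hs

conjS-involutive : ∀ s → conjS (conjS s) ≡ s
conjS-involutive (Gs , Hs) = cong (_, Hs) (conjList-involutive Gs)

Won-conj : ∀ w {s} → Won w s → Won (opp w) (conjS s)
Won-conj Lt = conjList-Any⁺ ∘ Any.map (cong conj)
Won-conj Rt = conjList-Any⁺ ∘ Any.map (cong conj)

Won-conj⁻ : ∀ w {s} → Won (opp w) (conjS s) → Won w s
Won-conj⁻ Lt = Any.map conj-swap ∘ conjList-Any⁻
Won-conj⁻ Rt = Any.map conj-swap ∘ conjList-Any⁻

Terminal-conj : ∀ {s} → Terminal (conjS s) → Terminal s
Terminal-conj {s} (inj₁ x) = inj₂ (Won-conj⁻ Rt {s} x)
Terminal-conj {s} (inj₂ x) = inj₁ (Won-conj⁻ Lt {s} x)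

optsOf-conj : ∀ p {G G'} → G' ∈ optsOf p G → conj G' ∈ optsOf (opp p) (conj G)
optsOf-conj Lt {⟨ L ∣ R ⟩} = conjList-∈⁺
optsOf-conj Rt {⟨ L ∣ R ⟩} = conjList-∈⁺

Move-conj : ∀ {p s s₁} → Move p s s₁ → Move (opp p) (conjS s) (conjS s₁)
Move-conj {p} (entMove pre post G G₁ Hs m) =
  subst₂ (λ Gs Gs₁ → Move (opp p) (Gs , Hs) (Gs₁ , Hs))
    (sym (conjList-++ pre (G ∷ post))) (sym (conjList-++ pre (G₁ ∷ post)))
    (entMove (conjList pre) (conjList post) (conj G) (conj G₁) Hs (optsOf-conj p m))
Move-conj (loopMove Gs pre post Rs x y m) = loopMove (conjList Gs) pre post Rs x y m

Wins-conj : ∀ {w p s} → Wins w p s → Wins (opp w) (opp p) (conjS s)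
Wins-conj {w} {s = s} (won x) = won (Won-conj w {s} x)
Wins-conj {Lt} {s = s} (moveW s₁ nt mv W) =
  moveW (conjS s₁) (nt ∘ Terminal-conj {s}) (Move-conj mv) (Wins-conj W)
Wins-conj {Rt} {s = s} (moveW s₁ nt mv W) =
  moveW (conjS s₁) (nt ∘ Terminal-conj {s}) (Move-conj mv) (Wins-conj W)
Wins-conj {Lt} {s = s} (allW nt f) = allW (nt ∘ Terminal-conj {s}) λ s₁ mv →
  subst (Wins Rt Rt) (conjS-involutive s₁)
    (Wins-conj (f (conjS s₁)
      (subst (λ z → Move Rt z (conjS s₁)) (conjS-involutive s) (Move-conj mv))))
Wins-conj {Rt} {s = s} (allW nt f) = allW (nt ∘ Terminal-conj {s}) λ s₁ mv →
  subst (Wins Lt Lt) (conjS-involutive s₁)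
    (Wins-conj (f (conjS s₁)
      (subst (λ z → Move Lt z (conjS s₁)) (conjS-involutive s) (Move-conj mv))))

Wins-swap : ∀ {w p s} → conjS s ≅ₛ s → Wins w p s → Wins (opp w) (opp p) s
Wins-swap self-conj = Wins-resp-≅ₛ self-conj ∘ Wins-conj

¬Won-both-after-Move : ∀ {p s s'} → ¬ Terminal s → Move p s s' → ¬ (Won Lt s' × Won Rt s')
¬Won-both-after-Move nt (entMove pre post G G' Hs m) (l , r) with Anyₚ.++⁻ pre l | Anyₚ.++⁻ pre r
... | inj₁ q | _ = nt (inj₁ (Anyₚ.++⁺ˡ q))
... | inj₂ (there q) | _ = nt (inj₁ (Anyₚ.++⁺ʳ pre (there q)))
... | _ | inj₁ q = nt (inj₂ (Anyₚ.++⁺ˡ q))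
... | _ | inj₂ (there q) = nt (inj₂ (Anyₚ.++⁺ʳ pre (there q)))
... | inj₂ (here refl) | inj₂ (here ())
¬Won-both-after-Move nt (loopMove _ _ _ _ _ _ _) (l , _) = nt (inj₁ l)

Wins-exclusive : ∀ {p s} → ¬ (Won Lt s × Won Rt s) → Wins Lt p s → Wins Rt p s → ⊥
Wins-exclusive ¬both (won l) (won r) = ¬both (l , r)
Wins-exclusive _ (won l) (moveW _ nt _ _) = nt (inj₁ l)
Wins-exclusive _ (won l) (allW nt _) = nt (inj₁ l)
Wins-exclusive _ (moveW _ nt _ _) (won r) = nt (inj₂ r)
Wins-exclusive _ (allW nt _) (won r) = nt (inj₂ r)
Wins-exclusive _ (moveW s' nt mv W) (allW _ f) =
  Wins-exclusive (¬Won-both-after-Move nt mv) W (f s' mv)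
Wins-exclusive _ (allW _ f) (moveW s' nt mv W) =
  Wins-exclusive (¬Won-both-after-Move nt mv) (f s' mv) W

Won⇒Terminal : ∀ w {s} → Won w s → Terminal s
Won⇒Terminal Lt = inj₁
Won⇒Terminal Rt = inj₂

¬Wins-when-opponent-won : ∀ {w s} → Won (opp w) s → ¬ Won w s → ¬ Wins w w s
¬Wins-when-opponent-won {Lt} _ ¬won (won x) = ¬won x
¬Wins-when-opponent-won {Rt} _ ¬won (won x) = ¬won x
¬Wins-when-opponent-won {Lt} {s} won' _ (moveW _ nt _ _) = nt (Won⇒Terminal Rt {s} won')
¬Wins-when-opponent-won {Rt} {s} won' _ (moveW _ nt _ _) = nt (Won⇒Terminal Lt {s} won')

Move-∷⁺ : ∀ {p X Gs Hs Gs' Hs'} → Move p (Gs , Hs) (Gs' , Hs') →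
          Move p (X ∷ Gs , Hs) (X ∷ Gs' , Hs')
Move-∷⁺ {X = X} (entMove pre post G G' Hs m) = entMove (X ∷ pre) post G G' Hs m
Move-∷⁺ {X = X} (loopMove Gs pre post Rs x y m) = loopMove (X ∷ Gs) pre post Rs x y m

Move-∷⁻ : ∀ {p s s' X Gs Hs} → Move p s s' → s ≡ (X ∷ Gs , Hs) →
  (∃ λ X' → X' ∈ optsOf p X × s' ≡ (X' ∷ Gs , Hs)) ⊎
  (∃₂ λ Gs' Hs' → s' ≡ (X ∷ Gs' , Hs') × Move p (Gs , Hs) (Gs' , Hs'))
Move-∷⁻ (entMove [] post G G' Hs m) refl = inj₁ (G' , m , refl)
Move-∷⁻ (entMove (_ ∷ pre) post G G' Hs m) refl = inj₂ (_ , _ , refl , entMove pre post G G' Hs m)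
Move-∷⁻ (loopMove (_ ∷ Gs) pre post Rs x y m) refl =
  inj₂ (_ , _ , refl , loopMove Gs pre post Rs x y m)

Move-to-∞ : ∀ {Gs} Hs → Any (λ G → ∞ ∈ leftOpts G) Gs →
  ∃ λ Gs' → Move Lt (Gs , Hs) (Gs' , Hs) × Won Lt (Gs' , Hs) × (All (_≢ ∞̄) Gs → All (_≢ ∞̄) Gs')
Move-to-∞ {G ∷ Gs} Hs (here m) =
  ∞ ∷ Gs , entMove [] Gs G ∞ Hs m , here refl , λ { (_ ∷ ≢∞̄) → (λ ()) ∷ ≢∞̄ }
Move-to-∞ {G ∷ _} Hs (there q) with Move-to-∞ Hs q
... | Gs' , mv , won' , keeps =
  G ∷ Gs' , Move-∷⁺ mv , there won' , λ { (G≢ ∷ ≢∞̄) → G≢ ∷ keeps ≢∞̄ }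

Left-takes-∞ : ∀ {Gs Hs} → All (_≢ ∞̄) Gs → Any (λ G → ∞ ∈ leftOpts G) Gs → ¬ Wins Rt Lt (Gs , Hs)
Left-takes-∞ ≢∞̄ _ (won r) = All¬⇒¬Any ≢∞̄ r
Left-takes-∞ {Hs = Hs} ≢∞̄ P (allW _ f) with Move-to-∞ Hs P
... | Gs' , mv , won' , keeps = ¬Wins-when-opponent-won won' (All¬⇒¬Any (keeps ≢∞̄)) (f _ mv)

NoRightWin : EGame → Set
NoRightWin G = G ≢ ∞̄ × ¬ ∞̄ ∈ rightOpts G

Right-Move-avoids-∞̄ : ∀ {s s'} → All NoRightWin (proj₁ s) → Move Rt s s' → All (_≢ ∞̄) (proj₁ s')
Right-Move-avoids-∞̄ safe (entMove pre post G G' Hs m) with Allₚ.++⁻ pre safe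
... | safe-pre , (_ , ∞̄∉) ∷ safe-post =
  Allₚ.++⁺ (All.map proj₁ safe-pre) ((λ { refl → ∞̄∉ m }) ∷ All.map proj₁ safe-post)
Right-Move-avoids-∞̄ safe (loopMove _ _ _ _ _ _ _) = All.map proj₁ safe

Symmetric⇒≢∞̄ : ∀ {G} → Symmetric G → G ≢ ∞̄
Symmetric⇒≢∞̄ {⟨ _ ∣ _ ⟩} _ ()

∞̄≅conj⇒≡∞ : ∀ {x} → ∞̄ ≅ conj x → x ≡ ∞
∞̄≅conj⇒≡∞ {∞} _ = refl
∞̄≅conj⇒≡∞ {∞̄} ()
∞̄≅conj⇒≡∞ {⟨ _ ∣ _ ⟩} ()

Symmetric-∞̄-right⇒∞-left : ∀ {G} → Symmetric G → ∞̄ ∈ rightOpts G → ∞ ∈ leftOpts G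
Symmetric-∞̄-right⇒∞-left {⟨ L ∣ R ⟩} (R⊆L̄ , _) m =
  Any.map (sym ∘ ∞̄≅conj⇒≡∞) (conjList-Any⁻ (All.lookup R⊆L̄ m))

module _ {n : ℕ} {A : List EGame} (*n∈A : nim n ∈ A)
         {Gs : List EGame} (symGs : All Symmetric Gs) where

  private
    ≢∞̄Gs : All (_≢ ∞̄) Gs
    ≢∞̄Gs = All.map Symmetric⇒≢∞̄ symGs

    ¬Won-Rt : ∀ {L R} → ¬ Any (_≡ ∞̄) (⟨ L ∣ R ⟩ ∷ Gs)
    ¬Won-Rt = All¬⇒¬Any ((λ ()) ∷ ≢∞̄Gs)

  *n+Gs-self-conjugate : ∀ Hs → conjS (nim n ∷ Gs , Hs) ≅ₛ (nim n ∷ Gs , Hs)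
  *n+Gs-self-conjugate Hs = conj-nim≅ n ∷ conjList-≅ symGs , refl

  SMoon-Right-loses-second-without-∞-options : ∀ Hs → ¬ Any (λ G → ∞ ∈ leftOpts G) Gs →
    ¬ Wins Rt Lt (SMoon n A ∷ Gs , Hs)
  SMoon-Right-loses-second-without-∞-options Hs _ (won r) = ¬Won-Rt r
  SMoon-Right-loses-second-without-∞-options Hs no∞ (allW _ f) =
    Right-loses-after-∞∣*n (f _ (entMove [] Gs (SMoon n A) ∞∣*n Hs (here refl)))
    where
    ∞∣*n : EGame
    ∞∣*n = ⟨ [ ∞ ] ∣ [ nim n ] ⟩

    Right-wins-*n+Gs : Wins Rt Rt (nim n ∷ Gs , Hs)
    Right-wins-*n+Gs = f _ (entMove [] Gs (SMoon n A) (nim n) Hs (there *n∈A))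

    noRightWin : All NoRightWin Gs
    noRightWin = All.zipWith
      (λ (symG , ¬∞) → Symmetric⇒≢∞̄ symG , ¬∞ ∘ Symmetric-∞̄-right⇒∞-left symG)
      (symGs , ¬Any⇒All¬ Gs no∞)

    Right-loses-after-∞∣*n : ¬ Wins Rt Rt (∞∣*n ∷ Gs , Hs)
    Right-loses-after-∞∣*n (won r) = ¬Won-Rt r
    Right-loses-after-∞∣*n (moveW _ _ mv W) with Move-∷⁻ mv refl
    ... | inj₁ (_ , here refl , refl) =
      Wins-exclusive (¬Won-Rt ∘ proj₂) (Wins-swap (*n+Gs-self-conjugate Hs) W) Right-wins-*n+Gs
    ... | inj₂ (Gs' , Hs' , refl , mv') =
      Left-takes-∞ ((λ ()) ∷ Right-Move-avoids-∞̄ noRightWin mv') (here (here refl)) W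

  SMoon-Right-loses-second : ∀ Hs → ¬ Wins Rt Lt (SMoon n A ∷ Gs , Hs)
  SMoon-Right-loses-second Hs W =
    SMoon-Right-loses-second-without-∞-options Hs
      (λ ∞opt → Left-takes-∞ ((λ ()) ∷ ≢∞̄Gs) (there ∞opt) W) W

self-conjugate⇒𝓝⊎𝓓 : ∀ {s} → conjS s ≅ₛ s → ¬ Wins Rt Lt s → ¬ ¬ (HasOutcome s 𝓝 ⊎ HasOutcome s 𝓓)
self-conjugate⇒𝓝⊎𝓓 {s} self-conj ¬RtLt k =
  -- the double negation provides the case split on whether Left wins s moving first
  k (inj₂ (¬LtLt , ¬RtLt , ¬RtLt ∘ Wins-swap self-conj , ¬LtLt ∘ Wins-swap self-conj))
  where
  ¬LtLt : ¬ Wins Lt Lt s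
  ¬LtLt W = k (inj₁ (W , Wins-swap self-conj W))

mainTheorem9 : (n : ℕ) (A : List EGame) → SMoonArg n A →
    (Gs : List EGame) → All InIms Gs → (Hs : List LPos) →
    ¬ ¬ (HasOutcome (SMoon n A ∷ Gs , Hs) 𝓝 ⊎ HasOutcome (SMoon n A ∷ Gs , Hs) 𝓓)
mainTheorem9 n A arg@(mkArg _ *n∈A) Gs ims Hs =
  self-conjugate⇒𝓝⊎𝓓 (NimOrSMoon⇒conj≅ (isSMoon n A arg) ∷ conjList-≅ symGs , refl)
                     (SMoon-Right-loses-second *n∈A symGs Hs)
  where
  symGs : All Symmetric Gs
  symGs = All.map (proj₁ ∘ proj₁) ims
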